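{- Let $G$ be a $\Gamma$-vertex-transitive graph, where $\Gamma$ is a subgroup of $\mathrm{Aut}(G)$ acting faithfully on $V(G)$. Suppose that $\Gamma$ has a subgroup $\Lambda$ of which every cyclic subgroup is normal in $\Gamma$. Then $\Lambda$ acts semiregularly on $V(G)$.
   Context: Graphs are finite, undirected, with parallel edges allowed; vertex-transitive graphs have no loops. $\mathrm{Aut}(G)$ consists of incidence-preserving bijections of $V(G)\cup E(G)$ mapping vertices to vertices and edges to edges. $G$ is $\Gamma$-vertex-transitive if $\Gamma\le\mathrm{Aut}(G)$ is transitive on $V(G)$. A group acts semiregularly on a set if no nonidentity element fixes a point. -}

module Defs where

open import Data.Nat using (ℕ; zero; suc)
open import Data.Integer using (ℤ; +_; -[1+_])
open import Data.Fin using (Fin)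
open import Data.Product using (Σ; ∃; _×_; _,_; proj₁; proj₂)
open import Data.Sum using (_⊎_; inj₁; inj₂)
open import Relation.Nullary using (¬_)
open import Relation.Binary.PropositionalEquality
  using (_≡_; refl; sym; trans; cong; subst)

-- A finite undirected multigraph: vertices Fin nV, edges Fin nE,
-- each edge has two ends (listed in some order; the order carries no
-- meaning, automorphisms only preserve the unordered pair of ends).
record Graph : Set where
  field
    nV    : ℕ
    nE    : ℕ
    end₁  : Fin nE → Fin nV
    end₂  : Fin nE → Fin nV

open Graph public

Loopless : Graph → Set
Loopless G = ∀ e → ¬ (end₁ G e ≡ end₂ G e)

record Aut (G : Graph) : Set where
  field
    vmap : Fin (nV G) → Fin (nV G)
    vinv : Fin (nV G) → Fin (nV G)
    emap : Fin (nE G) → Fin (nE G)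
    einv : Fin (nE G) → Fin (nE G)
    vmap-vinv : ∀ x → vmap (vinv x) ≡ x
    vinv-vmap : ∀ x → vinv (vmap x) ≡ x
    emap-einv : ∀ x → emap (einv x) ≡ x
    einv-emap : ∀ x → einv (emap x) ≡ x
    incid : ∀ e →
      (end₁ G (emap e) ≡ vmap (end₁ G e) × end₂ G (emap e) ≡ vmap (end₂ G e))
      ⊎ (end₁ G (emap e) ≡ vmap (end₂ G e) × end₂ G (emap e) ≡ vmap (end₁ G e))

open Aut public

module _ {G : Graph} where

  _≈_ : Aut G → Aut G → Set
  a ≈ b = (∀ v → vmap a v ≡ vmap b v) × (∀ e → emap a e ≡ emap b e)

  idA : Aut G
  idA = record
    { vmap = λ x → x ; vinv = λ x → x ; emap = λ x → x ; einv = λ x → x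
    ; vmap-vinv = λ _ → refl ; vinv-vmap = λ _ → refl
    ; emap-einv = λ _ → refl ; einv-emap = λ _ → refl
    ; incid = λ _ → inj₁ (refl , refl) }

  _∘A_ : Aut G → Aut G → Aut G
  a ∘A b = record
    { vmap = λ x → vmap a (vmap b x)
    ; vinv = λ x → vinv b (vinv a x)
    ; emap = λ x → emap a (emap b x)
    ; einv = λ x → einv b (einv a x)
    ; vmap-vinv = λ x → trans (cong (vmap a) (vmap-vinv b (vinv a x))) (vmap-vinv a x)
    ; vinv-vmap = λ x → trans (cong (vinv b) (vinv-vmap a (vmap b x))) (vinv-vmap b x)
    ; emap-einv = λ x → trans (cong (emap a) (emap-einv b (einv a x))) (emap-einv a x)
    ; einv-emap = λ x → trans (cong (einv b) (einv-emap a (emap b x))) (einv-emap b x)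
    ; incid = inc }
    where
    inc : ∀ e → _
    inc e with incid b e | incid a (emap b e)
    ... | inj₁ (p , q) | inj₁ (r , s) = inj₁ (trans r (cong (vmap a) p) , trans s (cong (vmap a) q))
    ... | inj₁ (p , q) | inj₂ (r , s) = inj₂ (trans r (cong (vmap a) q) , trans s (cong (vmap a) p))
    ... | inj₂ (p , q) | inj₁ (r , s) = inj₂ (trans r (cong (vmap a) p) , trans s (cong (vmap a) q))
    ... | inj₂ (p , q) | inj₂ (r , s) = inj₁ (trans r (cong (vmap a) q) , trans s (cong (vmap a) p))

  invA : Aut G → Aut G
  invA a = record
    { vmap = vinv a ; vinv = vmap a ; emap = einv a ; einv = emap a
    ; vmap-vinv = vinv-vmap a ; vinv-vmap = vmap-vinv a
    ; emap-einv = einv-emap a ; einv-emap = emap-einv a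
    ; incid = inc }
    where
    fix : ∀ {x y} → x ≡ vmap a y → vinv a x ≡ y
    fix {x} {y} p = trans (cong (vinv a) p) (vinv-vmap a y)
    inc : ∀ e → _
    inc e with incid a (einv a e)
    ... | inj₁ (p , q) = inj₁
      ( sym (fix (trans (cong (end₁ G) (sym (emap-einv a e))) p))
      , sym (fix (trans (cong (end₂ G) (sym (emap-einv a e))) q)) )
    ... | inj₂ (p , q) = inj₂
      ( sym (fix (trans (cong (end₂ G) (sym (emap-einv a e))) q))
      , sym (fix (trans (cong (end₁ G) (sym (emap-einv a e))) p)) )

  powℕ : Aut G → ℕ → Aut G
  powℕ a zero    = idA
  powℕ a (suc k) = a ∘A powℕ a k

  powℤ : Aut G → ℤ → Aut G
  powℤ a (+ k)      = powℕ a k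
  powℤ a -[1+ k ]   = invA (powℕ a (suc k))

  record IsSubgroup (H : Aut G → Set) : Set where
    field
      resp  : ∀ {a b} → a ≈ b → H a → H b
      id∈   : H idA
      ∘∈    : ∀ {a b} → H a → H b → H (a ∘A b)
      inv∈  : ∀ {a} → H a → H (invA a)

  InCyclic : Aut G → Aut G → Set
  InCyclic a x = ∃ λ (k : ℤ) → x ≈ powℤ a k

  CyclicNormalIn : (Aut G → Set) → Aut G → Set
  CyclicNormalIn Γ a =
    ∀ g → Γ g → ∀ x → InCyclic a x → InCyclic a ((g ∘A x) ∘A invA g)

  VertexTransitive : (Aut G → Set) → Set
  VertexTransitive Γ = ∀ u v → ∃ λ g → Γ g × vmap g u ≡ v

  FaithfulOnV : (Aut G → Set) → Set
  FaithfulOnV Γ = ∀ g → Γ g → (∀ v → vmap g v ≡ v) → g ≈ idA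

  SemiregularOnV : (Aut G → Set) → Set
  SemiregularOnV Λ = ∀ a → Λ a → ∀ v → vmap a v ≡ v → a ≈ idA

{-# OPTIONS --safe #-}
-- If a ∈ Λ fixes v, then so does every element of ⟨a⟩.  For any vertex w = g v with g ∈ Γ,
-- normality of ⟨a⟩ puts g⁻¹ a g in ⟨a⟩, so g⁻¹ a g fixes v, i.e. a fixes w.  Hence a fixes
-- every vertex, and faithfulness of Γ forces a = 1.
module Submission where

open import Defs
open import Data.Nat using (zero; suc)
open import Data.Fin using (Fin)
open import Data.Integer using (+_; -[1+_])
open import Data.Product using (_,_)
open import Relation.Binary.PropositionalEquality

module _ {G : Graph} where

  Fixes : Aut G → Fin (nV G) → Set
  Fixes a v = vmap a v ≡ v

  module _ (a : Aut G) {v : Fin (nV G)} (a-fixes-v : Fixes a v) where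

    powℕ-fixes : ∀ k → Fixes (powℕ a k) v
    powℕ-fixes zero    = refl
    powℕ-fixes (suc k) = trans (cong (vmap a) (powℕ-fixes k)) a-fixes-v

    invA-fixes : Fixes (invA a) v
    invA-fixes = trans (cong (vinv a) (sym a-fixes-v)) (vinv-vmap a v)

  powℤ-fixes : ∀ a {v} → Fixes a v → ∀ k → Fixes (powℤ a k) v
  powℤ-fixes a fx (+ k)    = powℕ-fixes a fx k
  powℤ-fixes a fx -[1+ k ] = invA-fixes (powℕ a (suc k)) (powℕ-fixes a fx (suc k))

  InCyclic-fixes : ∀ a x {v} → Fixes a v → InCyclic a x → Fixes x v
  InCyclic-fixes a x {v} fx (k , x≈aᵏ , _) = trans (x≈aᵏ v) (powℤ-fixes a fx k)

  generator-InCyclic : (a : Aut G) → InCyclic a a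
  generator-InCyclic a = + 1 , (λ _ → refl) , (λ _ → refl)

  conjugate-fixes : ∀ a g v → Fixes ((invA g ∘A a) ∘A invA (invA g)) v → Fixes a (vmap g v)
  conjugate-fixes a g v fx = begin
    vmap a (vmap g v)                     ≡⟨ sym (vmap-vinv g _) ⟩
    vmap g (vinv g (vmap a (vmap g v)))   ≡⟨ cong (vmap g) fx ⟩
    vmap g v                              ∎
    where open ≡-Reasoning

lemma4p1 : (G : Graph) → Loopless G →
    (Γ : Aut G → Set) → IsSubgroup Γ →
    VertexTransitive Γ → FaithfulOnV Γ →
    (Λ : Aut G → Set) → IsSubgroup Λ → (∀ a → Λ a → Γ a) →
    (∀ a → Λ a → CyclicNormalIn Γ a) →
    SemiregularOnV Λ
lemma4p1 G _ Γ Γ-subgroup transitive faithful Λ _ Λ⊆Γ normal a a∈Λ v a-fixes-v =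
  faithful a (Λ⊆Γ a a∈Λ) fixes-all
  where
  fixes-all : ∀ w → Fixes a w
  fixes-all w with transitive v w
  ... | g , g∈Γ , refl =
    conjugate-fixes a g v (InCyclic-fixes a g⁻¹ag a-fixes-v g⁻¹ag∈⟨a⟩)
    where
    g⁻¹ag : Aut G
    g⁻¹ag = (invA g ∘A a) ∘A invA (invA g)
    g⁻¹ag∈⟨a⟩ : InCyclic a g⁻¹ag
    g⁻¹ag∈⟨a⟩ = normal a a∈Λ (invA g) (IsSubgroup.inv∈ Γ-subgroup g∈Γ) a (generator-InCyclic a)
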